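{- Let $a,b,s,h$ be positive integers with $s\ge 2$ and $r=a+b$. If an $r$-uniform family $\mathcal H$ does not contain $\mathcal B_{s,h}(a,b)$, then there do not exist pairwise disjoint sets $A_0,B_1,\dots,B_s$ with $|A_0|=a$, $|B_1|=\dots=|B_s|=b$ such that each of $B_1,\dots,B_s$ is a $(b,shr)$-kernel in $\mathcal H$ and the sets $A_0\cup B_1,\dots,A_0\cup B_s$ are edges of $\mathcal H$.
   Context: A family $\{F_1,\dots,F_q\}$ of sets is a $q$-star (sunflower with $q$ petals) with kernel $K$ if $F_i\cap F_j=K$ for all $i\ne j$. A set $B$ is a $(b,q)$-kernel in a set system $\mathcal F$ if $|B|=b$ and $B$ is the kernel of a $q$-star formed by members of $\mathcal F$. The bush $\mathcal B_{s,h}(a,b)$ ($s\ge 2$) is the $r$-graph on pairwise disjoint sets $A$ ($|A|=a$), $B_1,\dots,B_s$ (size $b$), $A_{i,j}$ ($i\in[s],j\in[h]$, size $a$) with edges $A\cup B_i$ ($i\in[s]$) and $B_i\cup A_{i,j}$ ($i\in[s],j\in[h]$); "contains" means has a subfamily isomorphic to it. -}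

module Defs where

open import Data.Nat using (ℕ)
open import Data.Fin using (Fin)
open import Data.Fin.Subset using (Subset; ⊥; _∩_; _∪_; ∣_∣)
open import Data.Product using (Σ; _×_; _,_)
open import Relation.Binary.PropositionalEquality using (_≡_; _≢_)
open import Function.Definitions using (Injective)

Family : ℕ → Set₁
Family n = Subset n → Set

Uniform : ∀ {n} → ℕ → Family n → Set
Uniform r H = ∀ E → H E → ∣ E ∣ ≡ r

Disjoint : ∀ {n} → Subset n → Subset n → Set
Disjoint X Y = X ∩ Y ≡ ⊥

IsStar : ∀ {n} → Family n → (q : ℕ) → (Fin q → Subset n) → Subset n → Set
IsStar H q F K =
  Injective _≡_ _≡_ F × (∀ i → H (F i)) × (∀ i j → i ≢ j → F i ∩ F j ≡ K)

IsKernel : ∀ {n} → Family n → (b q : ℕ) → Subset n → Set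
IsKernel {n} H b q B = ∣ B ∣ ≡ b × Σ (Fin q → Subset n) (λ F → IsStar H q F B)

ContainsBush : ∀ {n} → Family n → (s h a b : ℕ) → Set
ContainsBush {n} H s h a b =
  Σ (Subset n) λ A →
  Σ (Fin s → Subset n) λ B →
  Σ (Fin s → Fin h → Subset n) λ C →
    (∣ A ∣ ≡ a) × (∀ i → ∣ B i ∣ ≡ b) × (∀ i j → ∣ C i j ∣ ≡ a) ×
    (∀ i → Disjoint A (B i)) ×
    (∀ i j → Disjoint A (C i j)) ×
    (∀ i i' → i ≢ i' → Disjoint (B i) (B i')) ×
    (∀ i i' j → Disjoint (B i) (C i' j)) ×
    (∀ i j i' j' → (i , j) ≢ (i' , j') → Disjoint (C i j) (C i' j')) ×
    (∀ i → H (A ∪ B i)) ×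
    (∀ i j → H (B i ∪ C i j))

-- Each kernel B i, being the kernel of a star with q = s h (a + b) members in an (a + b)-uniform
-- family, comes with q pairwise disjoint petals of size a, and B i together with any of its
-- petals is an edge. To complete A₀, B 1, ..., B s to a bush we need, for every star, h petals
-- avoiding A₀, the other kernels and all petals chosen so far. A set with fewer than q points
-- misses one of q pairwise disjoint sets, and the forbidden set never has more than
-- a + (s - 1) b + (s h - 1) a < q points, so the petals can be chosen greedily.
module Submission where

open import Defs
open import Data.Nat using (ℕ; zero; suc; _+_; _*_; _≥_; _>_; _≤_; _<_; s≤s; z≤n; >-nonZero)
open import Data.Nat.Properties
  using (+-suc; +-identityʳ; +-comm; +-assoc; m≤m+n; m≤n+m; ≤-reflexive; ≤-trans; ≤-pred; <-≤-trans; ≤-<-trans;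
         n<1+n; m≤m*n; +-mono-≤; +-monoˡ-≤; +-monoʳ-≤; +-monoˡ-<; +-monoʳ-<; *-monoˡ-<;
         +-cancelˡ-≡; +-cancelʳ-<; module ≤-Reasoning)
open import Data.Nat.Tactic.RingSolver using (solve-∀)
open import Data.Fin using (Fin; zero; suc; punchIn; punchOut; combine; remQuot; _≟_)
open import Data.Fin.Properties using (any?; punchInᵢ≢i; punchIn-injective; punchIn-punchOut; combine-injective; remQuot-combine)
open import Data.Fin.Subset using (Subset; inside; outside; _∈_; _∉_; _⊆_; _∪_; _∩_; ∁; _-_; ⋃; ∣_∣)
open import Data.Fin.Subset.Properties
  using (∉⊥; Empty-unique; nonempty?; _∈?_; ∣⊥∣≡0; ∩-comm; ∩-zeroʳ; ⊆-antisym; x∈p∩q⁺; x∈p∩q⁻; p∩q⊆p;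
         x∈p∪q⁻; p⊆p∪q; q⊆p∪q; x∈∁p⇒x∉p; x∉p⇒x∈∁p; x∈p∧x≢y⇒x∈p-y; x∈p⇒∣p-x∣<∣p∣)
open import Data.Vec using ([]; _∷_)
open import Data.List using (List; []; _∷_; length; tabulate)
open import Data.List.Properties using (length-tabulate)
open import Data.List.Relation.Unary.All using (All; []; _∷_)
open import Data.List.Relation.Unary.All.Properties using (tabulate⁺)
open import Data.List.Relation.Unary.Any using (here; there)
import Data.List.Membership.Propositional as List
open import Data.List.Membership.Propositional.Properties using (∈-tabulate⁺)
open import Data.Product using (Σ; ∃; _×_; _,_; proj₁; proj₂)
open import Data.Sum using (inj₁; inj₂)
open import Function using (_∘_; case_of_)
open import Relation.Nullary using (¬_; yes; no; contradiction)
open import Relation.Binary.PropositionalEquality using (_≡_; _≢_; refl; sym; trans; cong; cong₂; subst; module ≡-Reasoning)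

variable
  n : ℕ
  p q r : Subset n

PairwiseDisjoint : ∀ {I : Set} → (I → Subset n) → Set
PairwiseDisjoint P = ∀ i j → i ≢ j → Disjoint (P i) (P j)

Disjoint⇒∉ : Disjoint p q → ∀ {x} → x ∈ p → x ∉ q
Disjoint⇒∉ p∩q≡⊥ x∈p x∈q = ∉⊥ (subst (_ ∈_) p∩q≡⊥ (x∈p∩q⁺ (x∈p , x∈q)))

∉⇒Disjoint : (∀ {x} → x ∈ p → x ∉ q) → Disjoint p q
∉⇒Disjoint {p = p} {q} p∉q = Empty-unique λ (x , x∈p∩q) →
  let (x∈p , x∈q) = x∈p∩q⁻ p q x∈p∩q in p∉q x∈p x∈q

Disjoint-sym : Disjoint p q → Disjoint q p
Disjoint-sym {p = p} {q} p∩q≡⊥ = trans (∩-comm q p) p∩q≡⊥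

Disjoint-⊆ʳ : Disjoint p q → r ⊆ q → Disjoint p r
Disjoint-⊆ʳ p∩q≡⊥ r⊆q = ∉⇒Disjoint λ x∈p → Disjoint⇒∉ p∩q≡⊥ x∈p ∘ r⊆q

∣p∪q∣+∣p∩q∣≡∣p∣+∣q∣ : ∀ (p q : Subset n) → ∣ p ∪ q ∣ + ∣ p ∩ q ∣ ≡ ∣ p ∣ + ∣ q ∣
∣p∪q∣+∣p∩q∣≡∣p∣+∣q∣ []            []            = refl
∣p∪q∣+∣p∩q∣≡∣p∣+∣q∣ (outside ∷ p) (outside ∷ q) = ∣p∪q∣+∣p∩q∣≡∣p∣+∣q∣ p q
∣p∪q∣+∣p∩q∣≡∣p∣+∣q∣ (outside ∷ p) (inside ∷ q)  =
  trans (cong suc (∣p∪q∣+∣p∩q∣≡∣p∣+∣q∣ p q)) (sym (+-suc ∣ p ∣ ∣ q ∣))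
∣p∪q∣+∣p∩q∣≡∣p∣+∣q∣ (inside ∷ p)  (outside ∷ q) = cong suc (∣p∪q∣+∣p∩q∣≡∣p∣+∣q∣ p q)
∣p∪q∣+∣p∩q∣≡∣p∣+∣q∣ (inside ∷ p)  (inside ∷ q)  = cong suc (begin
  ∣ p ∪ q ∣ + suc ∣ p ∩ q ∣    ≡⟨ +-suc ∣ p ∪ q ∣ ∣ p ∩ q ∣ ⟩
  suc (∣ p ∪ q ∣ + ∣ p ∩ q ∣)  ≡⟨ cong suc (∣p∪q∣+∣p∩q∣≡∣p∣+∣q∣ p q) ⟩
  suc (∣ p ∣ + ∣ q ∣)          ≡⟨ +-suc ∣ p ∣ ∣ q ∣ ⟨
  ∣ p ∣ + suc ∣ q ∣            ∎)
  where open ≡-Reasoning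

∣p∪q∣≤∣p∣+∣q∣ : ∀ (p q : Subset n) → ∣ p ∪ q ∣ ≤ ∣ p ∣ + ∣ q ∣
∣p∪q∣≤∣p∣+∣q∣ p q = subst (∣ p ∪ q ∣ ≤_) (∣p∪q∣+∣p∩q∣≡∣p∣+∣q∣ p q) (m≤m+n _ _)

Disjoint⇒∣p∪q∣≡∣p∣+∣q∣ : Disjoint p q → ∣ p ∪ q ∣ ≡ ∣ p ∣ + ∣ q ∣
Disjoint⇒∣p∪q∣≡∣p∣+∣q∣ {n} {p} {q} p∩q≡⊥ = begin
  ∣ p ∪ q ∣               ≡⟨ +-identityʳ _ ⟨
  ∣ p ∪ q ∣ + 0           ≡⟨ cong (∣ p ∪ q ∣ +_) ∣p∩q∣≡0 ⟨
  ∣ p ∪ q ∣ + ∣ p ∩ q ∣   ≡⟨ ∣p∪q∣+∣p∩q∣≡∣p∣+∣q∣ p q ⟩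
  ∣ p ∣ + ∣ q ∣           ∎
  where
  open ≡-Reasoning
  ∣p∩q∣≡0 : ∣ p ∩ q ∣ ≡ 0
  ∣p∩q∣≡0 = trans (cong ∣_∣ p∩q≡⊥) (∣⊥∣≡0 n)

∣⋃ps∣≤length[ps]*b : ∀ {b} {ps : List (Subset n)} → All (λ p → ∣ p ∣ ≤ b) ps → ∣ ⋃ ps ∣ ≤ length ps * b
∣⋃ps∣≤length[ps]*b {n} []           = ≤-reflexive (∣⊥∣≡0 n)
∣⋃ps∣≤length[ps]*b {ps = p ∷ ps} (∣p∣≤b ∷ ∣ps∣≤b) =
  ≤-trans (∣p∪q∣≤∣p∣+∣q∣ p (⋃ ps)) (+-mono-≤ ∣p∣≤b (∣⋃ps∣≤length[ps]*b ∣ps∣≤b))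

p∈ps⇒p⊆⋃ps : ∀ {ps : List (Subset n)} → p List.∈ ps → p ⊆ ⋃ ps
p∈ps⇒p⊆⋃ps {ps = p ∷ ps} (here refl) = p⊆p∪q (⋃ ps)
p∈ps⇒p⊆⋃ps {ps = p ∷ ps} (there q∈ps) = q⊆p∪q p (⋃ ps) ∘ p∈ps⇒p⊆⋃ps q∈ps

Disjoint-∩∁ : ∀ (p q : Subset n) → Disjoint p (q ∩ ∁ p)
Disjoint-∩∁ p q = ∉⇒Disjoint λ x∈p x∈q∩∁p → x∈∁p⇒x∉p (proj₂ (x∈p∩q⁻ q (∁ p) x∈q∩∁p)) x∈p

p⊆q⇒p∪[q∩∁p]≡q : p ⊆ q → p ∪ (q ∩ ∁ p) ≡ q
p⊆q⇒p∪[q∩∁p]≡q {p = p} {q} p⊆q = ⊆-antisym ⊆q q⊆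
  where
  ⊆q : p ∪ (q ∩ ∁ p) ⊆ q
  ⊆q x∈ with x∈p∪q⁻ p (q ∩ ∁ p) x∈
  ... | inj₁ x∈p     = p⊆q x∈p
  ... | inj₂ x∈q∩∁p = p∩q⊆p q (∁ p) x∈q∩∁p
  q⊆ : q ⊆ p ∪ (q ∩ ∁ p)
  q⊆ {x} x∈q with x ∈? p
  ... | yes x∈p = p⊆p∪q (q ∩ ∁ p) x∈p
  ... | no  x∉p = q⊆p∪q p (q ∩ ∁ p) (x∈p∩q⁺ (x∈q , x∉p⇒x∈∁p x∉p))

record Petals (H : Family n) (a q : ℕ) (K : Subset n) : Set where
  field
    petal            : Fin q → Subset n
    ∣petal∣≡a         : ∀ k → ∣ petal k ∣ ≡ a
    petals-disjoint  : PairwiseDisjoint petal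
    kernel-disjoint  : ∀ k → Disjoint K (petal k)
    kernel∪petal∈H   : ∀ k → H (K ∪ petal k)

kernel⇒petals : ∀ {H : Family n} {a b q K} → Uniform (a + b) H → 2 ≤ q →
                IsKernel H b q K → Petals H a q K
kernel⇒petals {n} {H} {a} {b} {q@(suc (suc _))} {K} uniform (s≤s (s≤s _)) (∣K∣≡b , F , _ , F∈H , F∩F≡K) = record
  { petal           = petal
  ; ∣petal∣≡a        = ∣petal∣≡a
  ; petals-disjoint = petals-disjoint
  ; kernel-disjoint = λ k → Disjoint-∩∁ K (F k)
  ; kernel∪petal∈H  = λ k → subst H (sym (K∪petal≡F k)) (F∈H k)
  }
  where
  petal : Fin q → Subset n
  petal k = F k ∩ ∁ K

  K⊆F : ∀ k → K ⊆ F k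
  K⊆F k = subst (_⊆ F k) (F∩F≡K k l (punchInᵢ≢i k zero ∘ sym)) (p∩q⊆p (F k) (F l))
    where l = punchIn k zero

  K∪petal≡F : ∀ k → K ∪ petal k ≡ F k
  K∪petal≡F k = p⊆q⇒p∪[q∩∁p]≡q (K⊆F k)

  ∣petal∣≡a : ∀ k → ∣ petal k ∣ ≡ a
  ∣petal∣≡a k = +-cancelˡ-≡ b _ _ (begin
    b + ∣ petal k ∣       ≡⟨ cong (_+ ∣ petal k ∣) ∣K∣≡b ⟨
    ∣ K ∣ + ∣ petal k ∣   ≡⟨ Disjoint⇒∣p∪q∣≡∣p∣+∣q∣ (Disjoint-∩∁ K (F k)) ⟨
    ∣ K ∪ petal k ∣       ≡⟨ cong ∣_∣ (K∪petal≡F k) ⟩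
    ∣ F k ∣               ≡⟨ uniform (F k) (F∈H k) ⟩
    a + b                 ≡⟨ +-comm a b ⟩
    b + a                 ∎)
    where open ≡-Reasoning

  petals-disjoint : PairwiseDisjoint petal
  petals-disjoint k l k≢l = ∉⇒Disjoint λ x∈petal-k x∈petal-l →
    let (x∈F-k , x∈∁K) = x∈p∩q⁻ (F k) (∁ K) x∈petal-k
        (x∈F-l , _)    = x∈p∩q⁻ (F l) (∁ K) x∈petal-l
    in x∈∁p⇒x∉p x∈∁K (subst (_ ∈_) (F∩F≡K k l k≢l) (x∈p∩q⁺ (x∈F-k , x∈F-l)))

Disjoint-[q-x]⇒Disjoint-q : ∀ {x} → Disjoint p (q - x) → x ∉ p → Disjoint p q
Disjoint-[q-x]⇒Disjoint-q {x = x} p∩[q-x]≡⊥ x∉p = ∉⇒Disjoint λ {y} y∈p y∈q → case y ≟ x of λ where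
  (yes refl) → x∉p y∈p
  (no  y≢x)  → Disjoint⇒∉ p∩[q-x]≡⊥ y∈p (x∈p∧x≢y⇒x∈p-y y∈q y≢x)

-- Induction on q: delete a point x of p, and with it the (at most one) P k containing x.
∣p∣<q⇒∃-Disjoint : ∀ {q} (P : Fin q → Subset n) → PairwiseDisjoint P →
                   ∀ p → ∣ p ∣ < q → ∃ λ k → Disjoint (P k) p
∣p∣<q⇒∃-Disjoint {q = suc q} P P-disjoint p ∣p∣≤q with nonempty? p
... | no  p-empty = zero , trans (cong (P zero ∩_) (Empty-unique p-empty)) (∩-zeroʳ (P zero))
... | yes (x , x∈p) = case any? (λ k → x ∈? P k) of λ where
    (yes (k , x∈P-k)) → skipping k λ l → Disjoint⇒∉ (P-disjoint k (punchIn k l) (punchInᵢ≢i k l ∘ sym)) x∈P-k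
    (no  x∉P)         → skipping zero λ l x∈P-l → x∉P (punchIn zero l , x∈P-l)
  where
  skipping : ∀ k → (∀ l → x ∉ P (punchIn k l)) → ∃ λ k → Disjoint (P k) p
  skipping k x∉P' =
    let (l , P'-l∩[p-x]≡⊥) = ∣p∣<q⇒∃-Disjoint (P ∘ punchIn k)
                               (λ i j i≢j → P-disjoint _ _ (i≢j ∘ punchIn-injective k i j))
                               (p - x) (<-≤-trans (x∈p⇒∣p-x∣<∣p∣ x∈p) (≤-pred ∣p∣≤q))
    in punchIn k l , Disjoint-[q-x]⇒Disjoint-q P'-l∩[p-x]≡⊥ (x∉P' l)

DisjointRepresentatives : ∀ {m q} → (Fin m → Fin q → Subset n) → (Fin m → Subset n) → Set
DisjointRepresentatives {m = m} {q} R Y =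
  Σ (Fin m → Fin q) λ c → (∀ t → Disjoint (R t (c t)) (Y t)) × PairwiseDisjoint (λ t → R t (c t))

-- Greedily: the representative of slot 0 avoids Y 0 and is added to the sets the later slots
-- avoid, so each choice costs every later slot at most a points.
disjoint-representatives :
  ∀ {q} a m (R : Fin m → Fin q → Subset n) → (∀ t → PairwiseDisjoint (R t)) → (∀ t k → ∣ R t k ∣ ≤ a) →
  (Y : Fin m → Subset n) → (∀ t → ∣ Y t ∣ + m * a < q + a) → DisjointRepresentatives R Y
disjoint-representatives a zero R _ _ Y _ = (λ ()) , (λ ()) , (λ ())
disjoint-representatives {n} {q} a (suc m) R R-disjoint ∣R∣≤a Y ∣Y∣-small = c , R-c∩Y≡⊥ , R-c-disjoint
  where
  ∣Y₀∣<q : ∣ Y zero ∣ < q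
  ∣Y₀∣<q = +-cancelʳ-< a ∣ Y zero ∣ q
             (≤-<-trans (+-monoʳ-≤ ∣ Y zero ∣ (m≤m+n a (m * a))) (∣Y∣-small zero))

  first : ∃ λ k → Disjoint (R zero k) (Y zero)
  first = ∣p∣<q⇒∃-Disjoint (R zero) (R-disjoint zero) (Y zero) ∣Y₀∣<q

  R₀ : Subset n
  R₀ = R zero (proj₁ first)

  Y′ : Fin m → Subset n
  Y′ t = Y (suc t) ∪ R₀

  ∣Y′∣-small : ∀ t → ∣ Y′ t ∣ + m * a < q + a
  ∣Y′∣-small t = ≤-<-trans
    (+-monoˡ-≤ (m * a) (≤-trans (∣p∪q∣≤∣p∣+∣q∣ (Y (suc t)) R₀) (+-monoʳ-≤ ∣ Y (suc t) ∣ (∣R∣≤a zero _))))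
    (≤-<-trans (≤-reflexive (+-assoc ∣ Y (suc t) ∣ a (m * a))) (∣Y∣-small (suc t)))

  rest : DisjointRepresentatives (R ∘ suc) Y′
  rest = disjoint-representatives a m (R ∘ suc) (R-disjoint ∘ suc) (∣R∣≤a ∘ suc) Y′ ∣Y′∣-small

  avoids-R₀ : ∀ t → Disjoint (R (suc t) (proj₁ rest t)) R₀
  avoids-R₀ t = Disjoint-⊆ʳ (proj₁ (proj₂ rest) t) (q⊆p∪q (Y (suc t)) R₀)

  c : Fin (suc m) → Fin q
  c zero    = proj₁ first
  c (suc t) = proj₁ rest t

  R-c∩Y≡⊥ : ∀ t → Disjoint (R t (c t)) (Y t)
  R-c∩Y≡⊥ zero    = proj₂ first
  R-c∩Y≡⊥ (suc t) = Disjoint-⊆ʳ (proj₁ (proj₂ rest) t) (p⊆p∪q R₀)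

  R-c-disjoint : PairwiseDisjoint (λ t → R t (c t))
  R-c-disjoint zero    zero    0≢0 = contradiction refl 0≢0
  R-c-disjoint zero    (suc t) _   = Disjoint-sym (avoids-R₀ t)
  R-c-disjoint (suc t) zero    _   = avoids-R₀ t
  R-c-disjoint (suc t) (suc u) t≢u = proj₂ (proj₂ rest) t u (t≢u ∘ cong suc)

petal-budget : ∀ a b s₁ h → 0 < b → 0 < h →
               a + s₁ * b + suc s₁ * h * a < suc s₁ * h * (a + b) + a
petal-budget a b@(suc _) s₁ h@(suc _) _ _ = begin-strict
  a + s₁ * b + m * a   <⟨ +-monoˡ-< (m * a) (+-monoʳ-< a (*-monoˡ-< b s₁<m)) ⟩
  a + m * b + m * a    ≡⟨ rearrange a b m ⟩
  m * (a + b) + a      ∎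
  where
  open ≤-Reasoning
  m = suc s₁ * h
  s₁<m : s₁ < m
  s₁<m = ≤-trans (n<1+n s₁) (m≤m*n (suc s₁) h)
  rearrange : ∀ a b m → a + m * b + m * a ≡ m * (a + b) + a
  rearrange = solve-∀

petals⇒bush : ∀ {H : Family n} {s h a b} → 0 < s → 0 < h → 0 < b →
  (A₀ : Subset n) (B : Fin s → Subset n) → ∣ A₀ ∣ ≡ a → (∀ i → ∣ B i ∣ ≡ b) →
  (∀ i → Disjoint A₀ (B i)) → PairwiseDisjoint B → (∀ i → H (A₀ ∪ B i)) →
  (∀ i → Petals H a (s * h * (a + b)) (B i)) → ContainsBush H s h a b
petals⇒bush {n} {H} {s@(suc s₁)} {h} {a} {b} _ 0<h 0<b A₀ B ∣A₀∣≡a ∣B∣≡b A₀∩B≡⊥ B-disjoint A₀∪B∈H petals =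
  A₀ , B , C , ∣A₀∣≡a , ∣B∣≡b , ∣C∣≡a , A₀∩B≡⊥ , A₀∩C≡⊥ , B-disjoint , B∩C≡⊥ , C-disjoint , A₀∪B∈H , B∪C∈H
  where
  module P i = Petals (petals i)

  -- Slot t of the greedy choice takes a petal of the star at B (star t), with h slots per star.
  star : Fin (s * h) → Fin s
  star t = proj₁ (remQuot h t)

  star-combine : ∀ i j → star (combine i j) ≡ i
  star-combine i j = cong proj₁ (remQuot-combine i j)

  others : Fin s → Subset n
  others i = ⋃ (tabulate (B ∘ punchIn i))

  ∣others∣≤s₁*b : ∀ i → ∣ others i ∣ ≤ s₁ * b
  ∣others∣≤s₁*b i = subst (λ l → ∣ others i ∣ ≤ l * b) (length-tabulate (B ∘ punchIn i))
                     (∣⋃ps∣≤length[ps]*b (tabulate⁺ (≤-reflexive ∘ ∣B∣≡b ∘ punchIn i)))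

  B⊆others : ∀ {i j} → i ≢ j → B j ⊆ others i
  B⊆others {i} i≢j = subst (λ j → B j ⊆ others i) (punchIn-punchOut i≢j)
                       (p∈ps⇒p⊆⋃ps (∈-tabulate⁺ (punchOut i≢j)))

  Y : Fin (s * h) → Subset n
  Y t = A₀ ∪ others (star t)

  ∣Y∣-small : ∀ t → ∣ Y t ∣ + s * h * a < s * h * (a + b) + a
  ∣Y∣-small t = ≤-<-trans
    (+-monoˡ-≤ (s * h * a) (≤-trans (∣p∪q∣≤∣p∣+∣q∣ A₀ (others (star t)))
                                    (+-mono-≤ (≤-reflexive ∣A₀∣≡a) (∣others∣≤s₁*b (star t)))))
    (petal-budget a b s₁ h 0<b 0<h)

  choice : DisjointRepresentatives (P.petal ∘ star) Y
  choice = disjoint-representatives a (s * h) (P.petal ∘ star) (P.petals-disjoint ∘ star)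
             (λ t k → ≤-reflexive (P.∣petal∣≡a (star t) k)) Y ∣Y∣-small

  D : Fin (s * h) → Subset n
  D t = P.petal (star t) (proj₁ choice t)

  D∩Y≡⊥ : ∀ t → Disjoint (D t) (Y t)
  D∩Y≡⊥ = proj₁ (proj₂ choice)

  C : Fin s → Fin h → Subset n
  C i j = D (combine i j)

  ∣C∣≡a : ∀ i j → ∣ C i j ∣ ≡ a
  ∣C∣≡a i j = P.∣petal∣≡a _ _

  A₀∩C≡⊥ : ∀ i j → Disjoint A₀ (C i j)
  A₀∩C≡⊥ i j = Disjoint-sym (Disjoint-⊆ʳ (D∩Y≡⊥ (combine i j)) (p⊆p∪q _))

  B∩C≡⊥ : ∀ i i′ j → Disjoint (B i) (C i′ j)
  B∩C≡⊥ i i′ j with i ≟ star (combine i′ j)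
  ... | yes refl   = P.kernel-disjoint _ _
  ... | no  i≢star = Disjoint-sym (Disjoint-⊆ʳ (D∩Y≡⊥ (combine i′ j)) (q⊆p∪q A₀ _ ∘ B⊆others (i≢star ∘ sym)))

  C-disjoint : ∀ i j i′ j′ → (i , j) ≢ (i′ , j′) → Disjoint (C i j) (C i′ j′)
  C-disjoint i j i′ j′ ij≢i′j′ = proj₂ (proj₂ choice) _ _ λ eq →
    let (i≡i′ , j≡j′) = combine-injective i j i′ j′ eq in ij≢i′j′ (cong₂ _,_ i≡i′ j≡j′)

  B∪C∈H : ∀ i j → H (B i ∪ C i j)
  B∪C∈H i j = subst (λ i′ → H (B i′ ∪ C i j)) (star-combine i j) (P.kernel∪petal∈H _ _)

lemma7 : (a b s h : ℕ) → a > 0 → b > 0 → s ≥ 2 → h > 0 →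
    (n : ℕ) (H : Family n) → Uniform (a + b) H →
    ¬ ContainsBush H s h a b →
    ¬ (Σ (Subset n) λ A₀ → Σ (Fin s → Subset n) λ B →
         (∣ A₀ ∣ ≡ a) × (∀ i → ∣ B i ∣ ≡ b) ×
         (∀ i → Disjoint A₀ (B i)) ×
         (∀ i i' → i ≢ i' → Disjoint (B i) (B i')) ×
         (∀ i → IsKernel H b (s * h * (a + b)) (B i)) ×
         (∀ i → H (A₀ ∪ B i)))
lemma7 a b s h _ 0<b 2≤s 0<h n H uniform no-bush (A₀ , B , ∣A₀∣≡a , ∣B∣≡b , A₀∩B≡⊥ , B-disjoint , B-kernel , A₀∪B∈H) =
  no-bush (petals⇒bush (<-≤-trans (s≤s z≤n) 2≤s) 0<h 0<b A₀ B ∣A₀∣≡a ∣B∣≡b A₀∩B≡⊥ B-disjoint A₀∪B∈H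
             λ i → kernel⇒petals uniform 2≤q (B-kernel i))
  where
  2≤q : 2 ≤ s * h * (a + b)
  2≤q = ≤-trans 2≤s (≤-trans (m≤m*n s h {{>-nonZero 0<h}})
                             (m≤m*n (s * h) (a + b) {{>-nonZero (≤-trans 0<b (m≤n+m b a))}}))
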